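{- For $m,n\geq 0$, \[ F_{m,n}(q,t) = \sum_{a=0}^{\min\{m,n\}} \binom{m}{a}\binom{n}{a} q^a(q+1)^a(q+t+1)^{m+n-2a}. \]
   Context: Let $X=\{x_1,\dots,x_m\}$, $Y=\{y_1,\dots,y_n\}$, $\tilde X=X\cup\{x_0\}$, $\tilde Y=Y\cup\{y_0\}$. Loops are elements of $\mathcal L=X\uplus Y$; edges are elements of $\tilde{\mathcal E}=\{\{x,y\}:x\in\tilde X,y\in\tilde Y\}\setminus\{\{x_0,y_0\}\}$. The noncrossing bipartite complex $\Delta(m,n)$ is the simplicial complex on vertex set $\mathcal L\uplus\tilde{\mathcal E}$ whose faces are the sets $\sigma$ with: (i) if $\{x,y\}\in\sigma$ then $x\notin\sigma$ and $y\notin\sigma$; (ii) if $\{x_{s_1},y_{t_1}\},\{x_{s_2},y_{t_2}\}\in\sigma$ with $s_1<s_2$ then $t_1<t_2$. The $F$-triangle is $F_{m,n}(q,t)=\sum_{\sigma\in\Delta(m,n)} q^{|\sigma\cap\tilde{\mathcal E}|}t^{|\sigma\cap\mathcal L|}$. -}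

module Defs where

open import Level using (Level)
open import Data.Bool using (Bool; true; false)
open import Data.Bool.Properties using () renaming (_≟_ to _≟ᵇ_)
open import Data.Nat as ℕ using (ℕ; zero; suc; _∸_; _⊓_)
open import Data.Nat.Combinatorics using (_C_)
open import Data.Fin using (Fin; zero; suc; _<_; _<?_; _≤_; _≤?_)
open import Data.Fin.Properties using (all?)
open import Data.List using (List; []; _∷_; map; concatMap; filter; foldr; upTo; allFin)
open import Data.Product using (_×_; _,_)
open import Relation.Binary.PropositionalEquality using (_≡_)
open import Relation.Nullary using (Dec)
open import Relation.Nullary.Decidable using (_×-dec_; _→-dec_)
open import Algebra.Bundles using (CommutativeSemiring)
import Algebra.Definitions.RawSemiring as RS

-- Vertices of Δ(m,n).
-- x_0,…,x_m are indexed by Fin (suc m) (zero = x_0, suc i = x_{i+1});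
-- likewise y_0,…,y_n by Fin (suc n).  Loops are x_1..x_m (Fin m) and
-- y_1..y_n (Fin n).  A set of vertices σ is given by its indicator
-- functions: on the loops of X, on the loops of Y, and on the pairs
-- {x_s, y_t} (s ∈ Fin (suc m), t ∈ Fin (suc n)); the pair {x_0,y_0} is
-- not a vertex, so its indicator is required to be false.

VSet : ℕ → ℕ → Set
VSet m n = (Fin m → Bool) × (Fin n → Bool) × (Fin (suc m) → Fin (suc n) → Bool)

IsFace : ∀ {m n} → VSet m n → Set
IsFace {m} {n} (lx , ly , e) =
  (e zero zero ≡ false) ×
  -- (i) if {x,y} ∈ σ then x ∉ σ and y ∉ σ
  (∀ (i : Fin m) (j : Fin (suc n)) → e (suc i) j ≡ true → lx i ≡ false) ×
  (∀ (i : Fin (suc m)) (j : Fin n) → e i (suc j) ≡ true → ly j ≡ false) ×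
  (∀ (s₁ s₂ : Fin (suc m)) (t₁ t₂ : Fin (suc n)) →
     e s₁ t₁ ≡ true → e s₂ t₂ ≡ true → s₁ < s₂ → t₁ ≤ t₂)

isFace? : ∀ {m n} (σ : VSet m n) → Dec (IsFace σ)
isFace? (lx , ly , e) =
  (e zero zero ≟ᵇ false) ×-dec
  (all? λ i → all? λ j → (e (suc i) j ≟ᵇ true) →-dec (lx i ≟ᵇ false)) ×-dec
  (all? λ i → all? λ j → (e i (suc j) ≟ᵇ true) →-dec (ly j ≟ᵇ false)) ×-dec
  (all? λ s₁ → all? λ s₂ → all? λ t₁ → all? λ t₂ →
     (e s₁ t₁ ≟ᵇ true) →-dec ((e s₂ t₂ ≟ᵇ true) →-dec ((s₁ <? s₂) →-dec (t₁ ≤? t₂))))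

funs : ∀ {a} {A : Set a} (k : ℕ) → List A → List (Fin k → A)
funs zero    xs = (λ ()) ∷ []
funs (suc k) xs =
  concatMap (λ x → map (λ f → λ { zero → x ; (suc i) → f i }) (funs k xs)) xs

bools : List Bool
bools = false ∷ true ∷ []

allVSets : (m n : ℕ) → List (VSet m n)
allVSets m n =
  concatMap (λ lx → concatMap (λ ly → map (λ e → lx , ly , e)
      (funs (suc m) (funs (suc n) bools)))
    (funs n bools))
  (funs m bools)

faces : (m n : ℕ) → List (VSet m n)
faces m n = filter isFace? (allVSets m n)

count : ∀ {k} → (Fin k → Bool) → ℕ
count f = foldr (λ i acc → (Data.Bool.if f i then 1 else 0) ℕ.+ acc) 0 (allFin _)

#loops : ∀ {m n} → VSet m n → ℕ
#loops (lx , ly , e) = count lx ℕ.+ count ly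

#edges : ∀ {m n} → VSet m n → ℕ
#edges (lx , ly , e) = foldr (λ i acc → count (e i) ℕ.+ acc) 0 (allFin _)

-- The F-triangle and the right-hand side, evaluated at q, t in an
-- arbitrary commutative semiring (a polynomial identity in ℕ[q,t] is the
-- same as the identity holding in every commutative semiring).

module _ {c ℓ : Level} (R : CommutativeSemiring c ℓ) where
  open CommutativeSemiring R
  open RS rawSemiring using (_^_) renaming (_×_ to _·_)

  Σ-list : ∀ {a} {A : Set a} → (A → Carrier) → List A → Carrier
  Σ-list f = foldr (λ x acc → f x + acc) 0#

  F-triangle : (m n : ℕ) (q t : Carrier) → Carrier
  F-triangle m n q t = Σ-list (λ σ → (q ^ #edges σ) * (t ^ #loops σ)) (faces m n)

  F-formula : (m n : ℕ) (q t : Carrier) → Carrier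
  F-formula m n q t =
    Σ-list (λ a → ((m C a) ℕ.* (n C a)) ·
                   ((q ^ a) * ((q + 1#) ^ a) * ((q + t + 1#) ^ (m ℕ.+ n ∸ 2 ℕ.* a))))
           (upTo (suc (m ⊓ n)))

-- Summing out the loops first, a face becomes a noncrossing edge set E, weighted by q^|E| and by
-- u = 1 + t for every row xᵢ and column yⱼ (i, j ≥ 1) that E does not meet. Read from x₀ upwards, each
-- nonempty row of E starts at or after the last column used before it, so E can be summed row by row.
-- With p columns beyond the last one reached, k more rows contribute H k p, where H 0 p = uᵖ and
-- H (k+1) p = w H k p + r Σ_{j<p} w^(p-1-j) H k j, w = q + t + 1, r = q(q + 1): the next row is empty or
-- uses only the last column reached (weight w), or it ends d ≥ 1 columns further on (weight
-- q(q + 1)w^(d-1)). Since x₀ carries no loop and misses y₀, F = H m n + q Σ_{j<n} w^(n-1-j) H m j. This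
-- combination satisfies the same recurrence with initial values wᵖ, and by Pascal's rule so does
-- Σₐ C(k,a) C(p,a) rᵃ w^(k+p-2a).
module Submission where

open import Level using (Level)
open import Function using (_∘_; _⇔_; mk⇔; Equivalence)
open import Function.Properties.Equivalence using () renaming (refl to ⇔-refl; trans to ⇔-trans; sym to ⇔-sym)
open import Data.Bool using (Bool; true; false; not; _∧_; _∨_; if_then_else_; T)
open import Data.Bool.Properties
  using (∧-conicalˡ; ∧-conicalʳ; ∧-identityʳ; ∨-zeroʳ; ∨-identityʳ; not-injective; ⇔→≡; T-≡; T-not-≡; T-∧;
         ∧-commutativeMonoid)
open import Data.Nat as ℕ using (ℕ; zero; suc; _∸_; _≤ᵇ_; _<ᵇ_; _⊔_; _⊓_; z≤n; s≤s)
import Data.Nat.Properties as ℕ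
open import Data.Nat.Combinatorics using (_C_; nCk+nC[k+1]≡[n+1]C[k+1]; k>n⇒nCk≡0)
open import Data.Nat.GeneralisedArithmetic using (fold)
open import Data.Fin as Fin using (Fin; zero; suc; toℕ)
import Data.Fin.Properties as Fin
open import Data.List using (List; []; _∷_; _++_; map; concatMap; filter; foldr; tabulate; applyUpTo)
import Data.Vec.Functional as V
open import Data.Product using (_×_; _,_; ∃)
open import Data.Product.Function.NonDependent.Propositional using (_×-⇔_)
open import Data.Sum as Sum using (_⊎_; inj₁; inj₂)
open import Relation.Binary.PropositionalEquality as ≡ using (_≡_)
open import Relation.Nullary using (does; ¬_; yes; no)
open import Relation.Nullary.Decidable using (does-⇔; T?)
open import Relation.Nullary.Negation using (contradiction)
open import Relation.Unary using (Decidable)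
open import Algebra.Bundles using (CommutativeMonoid; CommutativeSemiring)
import Algebra.Definitions.RawSemiring as RS
open import Algebra.Properties.Monoid.Sum ℕ.+-0-monoid using () renaming (sum to ∑ᴺ; sum-cong-≗ to ∑ᴺ-cong)
open import Algebra.Properties.CommutativeSemigroup (CommutativeMonoid.commutativeSemigroup ∧-commutativeMonoid)
  using () renaming (interchange to ∧-interchange)

open import Defs

all any : ∀ {k} → (Fin k → Bool) → Bool
all {zero}  f = true
all {suc k} f = f zero ∧ all (f ∘ suc)
any {zero}  f = false
any {suc k} f = f zero ∨ any (f ∘ suc)

all-sound : ∀ {k} {f : Fin k → Bool} → all f ≡ true → ∀ i → f i ≡ true
all-sound {suc k} h zero    = ∧-conicalˡ _ _ h
all-sound {suc k} h (suc i) = all-sound (∧-conicalʳ _ _ h) i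

all-complete : ∀ {k} {f : Fin k → Bool} → (∀ i → f i ≡ true) → all f ≡ true
all-complete {zero}  h = ≡.refl
all-complete {suc k} h = ≡.cong₂ _∧_ (h zero) (all-complete (h ∘ suc))

all-cong : ∀ {k} {f g : Fin k → Bool} → (∀ i → f i ≡ g i) → all f ≡ all g
all-cong {zero}  f≗g = ≡.refl
all-cong {suc k} f≗g = ≡.cong₂ _∧_ (f≗g zero) (all-cong (f≗g ∘ suc))

any-complete : ∀ {k} {f : Fin k → Bool} i → f i ≡ true → any f ≡ true
any-complete {f = f} zero    h rewrite h = ≡.refl
any-complete {f = f} (suc i) h = ≡.trans (≡.cong (f zero ∨_) (any-complete i h)) (∨-zeroʳ (f zero))

any-sound : ∀ {k} {f : Fin k → Bool} → any f ≡ true → ∃ λ i → f i ≡ true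
any-sound {suc k} {f} h with f zero in f₀
... | true  = zero , f₀
... | false with any-sound h
...   | i , fi = suc i , fi

-- top x = 1 + the largest j with x j = true, or 0 if there is none.
top-step : Bool → ℕ → ℕ
top-step b zero    = if b then 1 else 0
top-step b (suc a) = suc (suc a)

top : ∀ {k} → (Fin k → Bool) → ℕ
top {zero}  x = 0
top {suc k} x = top-step (x zero) (top (x ∘ suc))

top-upper : ∀ {k} (x : Fin k → Bool) j → x j ≡ true → suc (toℕ j) ℕ.≤ top x
top-upper x zero h with top (x ∘ suc)
... | zero  rewrite h = s≤s z≤n
... | suc a = s≤s z≤n
top-upper x (suc j) h with top (x ∘ suc) | top-upper (x ∘ suc) j h
... | suc a | j<a = s≤s j<a

top-attained : ∀ {k} (x : Fin k → Bool) → top x ≡ 0 ⊎ ∃ λ j → x j ≡ true × top x ≡ suc (toℕ j)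
top-attained {zero}  x = inj₁ ≡.refl
top-attained {suc k} x with top (x ∘ suc) | top-attained (x ∘ suc) | x zero in x₀
... | suc _ | inj₂ (j , xj , ≡.refl) | _     = inj₂ (suc j , xj , ≡.refl)
... | zero  | _                    | true  = inj₂ (zero , x₀ , ≡.refl)
... | zero  | _                    | false = inj₁ ≡.refl

top-least : ∀ {k} (x : Fin k → Bool) a → (∀ j → x j ≡ true → suc (toℕ j) ℕ.≤ a) → top x ℕ.≤ a
top-least x a h with top-attained x
... | inj₁ eq            rewrite eq = z≤n
... | inj₂ (j , xj , eq) rewrite eq = h j xj

top-true : ∀ {k} (x : Fin k → Bool) j → top x ≡ suc (toℕ j) → x j ≡ true
top-true x j h with top-attained x
... | inj₁ eq with () ← ≡.trans (≡.sym h) eq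
... | inj₂ (j′ , xj′ , eq) =
  ≡.subst (λ i → x i ≡ true) (Fin.toℕ-injective (ℕ.suc-injective (≡.trans (≡.sym eq) h))) xj′

size : ∀ {k} → (Fin k → Bool) → ℕ
size x = ∑ᴺ λ j → if x j then 1 else 0

edgeCount : ∀ {k N} → (Fin k → Fin N → Bool) → ℕ
edgeCount g = ∑ᴺ (size ∘ g)

foldr-tabulate : ∀ {a} {A : Set a} {k} (h : A → ℕ) (f : Fin k → A) →
  foldr (λ a acc → h a ℕ.+ acc) 0 (tabulate f) ≡ ∑ᴺ (h ∘ f)
foldr-tabulate {k = zero}  h f = ≡.refl
foldr-tabulate {k = suc k} h f = ≡.cong (h (f zero) ℕ.+_) (foldr-tabulate h (f ∘ suc))

count≡size : ∀ {k} (x : Fin k → Bool) → count x ≡ size x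
count≡size x = foldr-tabulate (λ j → if x j then 1 else 0) (λ i → i)

#loops≡ : ∀ {m n} (lx : Fin m → Bool) (ly : Fin n → Bool) e → #loops (lx , ly , e) ≡ size lx ℕ.+ size ly
#loops≡ lx ly e = ≡.cong₂ ℕ._+_ (count≡size lx) (count≡size ly)

#edges≡ : ∀ {m n} (lx : Fin m → Bool) (ly : Fin n → Bool) e → #edges (lx , ly , e) ≡ edgeCount e
#edges≡ lx ly e = ≡.trans (foldr-tabulate (count ∘ e) (λ i → i)) (∑ᴺ-cong (count≡size ∘ e))

empty-top : ∀ {k} (x : Fin k → Bool) → any x ≡ false → top x ≡ 0
empty-top x none = ℕ.n≤0⇒n≡0 (top-least x 0 λ j xj → contradiction (≡.trans (≡.sym (any-complete j xj)) none) λ ())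

empty-size : ∀ {k} (x : Fin k → Bool) → any x ≡ false → size x ≡ 0
empty-size {zero}  x none = ≡.refl
empty-size {suc k} x none with x zero
... | false = empty-size (x ∘ suc) none

nonempty-top : ∀ {k} (x : Fin k → Bool) → any x ≡ true → ∃ λ a → top x ≡ suc a
nonempty-top x some with any-sound some
... | j , xj with top x | top-upper x j xj
...   | suc a | _ = a , ≡.refl

≤ᵇ≡true⇒≤ : ∀ {m n} → (m ≤ᵇ n) ≡ true → m ℕ.≤ n
≤ᵇ≡true⇒≤ {m} {n} h = ℕ.≤ᵇ⇒≤ m n (Equivalence.from T-≡ h)

≤⇒≤ᵇ≡true : ∀ {m n} → m ℕ.≤ n → (m ≤ᵇ n) ≡ true
≤⇒≤ᵇ≡true h = Equivalence.to T-≡ (ℕ.≤⇒≤ᵇ h)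

≰⇒≤ᵇ≡false : ∀ {m n} → ¬ m ℕ.≤ n → (m ≤ᵇ n) ≡ false
≰⇒≤ᵇ≡false {m} {n} m≰n with m ≤ᵇ n in eq
... | false = ≡.refl
... | true  = contradiction (≤ᵇ≡true⇒≤ eq) m≰n

≤ᵇ≡false⇒≰ : ∀ {m n} → (m ≤ᵇ n) ≡ false → ¬ m ℕ.≤ n
≤ᵇ≡false⇒≰ eq m≤n with () ← ≡.trans (≡.sym eq) (≤⇒≤ᵇ≡true m≤n)

<ᵇ-suc : ∀ s n → (s <ᵇ suc n) ≡ (s ≤ᵇ n)
<ᵇ-suc zero    n = ≡.refl
<ᵇ-suc (suc s) n = ≡.refl

-- A threshold s is the top of an earlier row: a row allowed at threshold s may still use column
-- s - 1, the last column used before it, but no column to its left.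
allowed : ∀ {N} → ℕ → (Fin N → Bool) → Bool
allowed s x = all λ j → not (x j) ∨ (s ≤ᵇ suc (toℕ j))

above : ∀ {k N} → ℕ → (Fin k → Fin N → Bool) → Bool
above s g = all λ i → allowed s (g i)

chain : ∀ {k N} → (Fin k → Fin N → Bool) → Bool
chain {zero}  g = true
chain {suc k} g = above (top (g zero)) (g ∘ suc) ∧ chain (g ∘ suc)

allowed-sound : ∀ {N} s (x : Fin N → Bool) → allowed s x ≡ true → ∀ j → x j ≡ true → s ℕ.≤ suc (toℕ j)
allowed-sound s x h j xj with all-sound h j
... | ok rewrite xj = ≤ᵇ≡true⇒≤ ok

allowed-complete : ∀ {N} s (x : Fin N → Bool) → (∀ j → x j ≡ true → s ℕ.≤ suc (toℕ j)) → allowed s x ≡ true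
allowed-complete s x h = all-complete λ j → cell j (x j) ≡.refl
  where
  cell : ∀ j b → x j ≡ b → not b ∨ _ ≡ true
  cell j false _  = ≡.refl
  cell j true  xj = ≤⇒≤ᵇ≡true (h j xj)

Noncrossing : ∀ {k N} → (Fin k → Fin N → Bool) → Set
Noncrossing e = ∀ s₁ s₂ t₁ t₂ → e s₁ t₁ ≡ true → e s₂ t₂ ≡ true → s₁ Fin.< s₂ → t₁ Fin.≤ t₂

chain-sound : ∀ {k N} {e : Fin k → Fin N → Bool} → chain e ≡ true → Noncrossing e
chain-sound h zero    (suc s₂) t₁ t₂ e₁ e₂ _ =
  ℕ.≤-pred (ℕ.≤-trans (top-upper _ t₁ e₁) (allowed-sound _ _ (all-sound (∧-conicalˡ _ _ h) s₂) t₂ e₂))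
chain-sound h (suc s₁) (suc s₂) t₁ t₂ e₁ e₂ (s≤s lt) = chain-sound (∧-conicalʳ _ _ h) s₁ s₂ t₁ t₂ e₁ e₂ lt

chain-complete : ∀ {k N} {e : Fin k → Fin N → Bool} → Noncrossing e → chain e ≡ true
chain-complete {zero}  nc = ≡.refl
chain-complete {suc k} nc = ≡.cong₂ _∧_
  (all-complete λ i → allowed-complete _ _ λ t₂ e₂ →
    top-least _ _ λ t₁ e₁ → s≤s (nc zero (suc i) t₁ t₂ e₁ e₂ (s≤s z≤n)))
  (chain-complete λ s₁ s₂ t₁ t₂ e₁ e₂ lt → nc (suc s₁) (suc s₂) t₁ t₂ e₁ e₂ (s≤s lt))

column : ∀ {k N} → (Fin k → Fin N → Bool) → Fin N → Bool
column g j = any λ i → g i j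

next : ∀ {N} → ℕ → (Fin N → Bool) → ℕ
next s x = s ⊔ top x

suc-⊔-top-step : ∀ s b a → suc s ⊔ top-step b a ≡ suc (s ⊔ a)
suc-⊔-top-step s true  zero    = ≡.refl
suc-⊔-top-step s false zero    = ≡.cong suc (≡.sym (ℕ.⊔-identityʳ s))
suc-⊔-top-step s b     (suc a) = ≡.refl

allowed-1 : ∀ {N} (x : Fin N → Bool) → allowed 1 x ≡ true
allowed-1 x = all-complete λ j → ∨-zeroʳ (not (x j))

above-1 : ∀ {k N} (g : Fin k → Fin N → Bool) → above 1 g ≡ true
above-1 g = all-complete λ i → allowed-1 (g i)

allowed-⊔ : ∀ {N} a b (x : Fin N → Bool) → allowed (a ⊔ b) x ≡ allowed a x ∧ allowed b x
allowed-⊔ a b x = ⇔→≡ (mk⇔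
  (λ h → ≡.cong₂ _∧_ (allowed-complete a x λ j xj → ℕ.≤-trans (ℕ.m≤m⊔n a b) (allowed-sound (a ⊔ b) x h j xj))
                     (allowed-complete b x λ j xj → ℕ.≤-trans (ℕ.m≤n⊔m a b) (allowed-sound (a ⊔ b) x h j xj)))
  (λ h → allowed-complete (a ⊔ b) x λ j xj →
     ℕ.⊔-lub (allowed-sound a x (∧-conicalˡ _ _ h) j xj) (allowed-sound b x (∧-conicalʳ _ _ h) j xj)))

all-∧ : ∀ {k} (f g : Fin k → Bool) → all (λ i → f i ∧ g i) ≡ all f ∧ all g
all-∧ {zero}  f g = ≡.refl
all-∧ {suc k} f g = ≡.trans (≡.cong ((f zero ∧ g zero) ∧_) (all-∧ (f ∘ suc) (g ∘ suc)))
  (∧-interchange (f zero) (g zero) (all (f ∘ suc)) (all (g ∘ suc)))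

above-⊔ : ∀ {k N} a b (g : Fin k → Fin N → Bool) → above (a ⊔ b) g ≡ above a g ∧ above b g
above-⊔ a b g = ≡.trans (all-cong λ i → allowed-⊔ a b (g i)) (all-∧ (λ i → allowed a (g i)) (λ i → allowed b (g i)))

column-bound : ∀ {k N} {a} {g : Fin k → Fin N → Bool} → above a g ≡ true →
  ∀ j → column g j ≡ true → a ℕ.≤ suc (toℕ j)
column-bound {a = a} {g} ab j cj with any-sound {f = λ i → g i j} cj
... | i , gij = allowed-sound a (g i) (all-sound {f = λ i → allowed a (g i)} ab i) j gij

loopFree : ∀ {k K} → (Fin k → Fin K → Bool) → (Fin k → Bool) → Bool
loopFree G l = all λ i → not (l i) ∨ not (any (G i))

loopFree-⇔ : ∀ {k K} {G : Fin k → Fin K → Bool} {l : Fin k → Bool} →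
  (∀ i j → G i j ≡ true → l i ≡ false) ⇔ (loopFree G l ≡ true)
loopFree-⇔ {G = G} {l} = mk⇔ (λ h → all-complete λ i → cell h i (l i) ≡.refl) sound
  where
  cell : (∀ i j → G i j ≡ true → l i ≡ false) → ∀ i b → l i ≡ b → not b ∨ not (any (G i)) ≡ true
  cell h i false _ = ≡.refl
  cell h i true li with any (G i) in a
  ... | false = ≡.refl
  ... | true with any-sound a
  ...   | j , gij with () ← ≡.trans (≡.sym li) (h i j gij)
  sound : loopFree G l ≡ true → ∀ i j → G i j ≡ true → l i ≡ false
  sound h i j gij = not-injective (≡.trans (≡.sym (∨-identityʳ _))
    (≡.subst (λ b → not (l i) ∨ not b ≡ true) (any-complete j gij) (all-sound h i)))

face : ∀ {m n} → VSet m n → Bool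
face (lx , ly , e) =
  not (e zero zero) ∧ loopFree (e ∘ suc) lx ∧ loopFree (λ j i → e i (suc j)) ly ∧ chain e

face-⇔ : ∀ {m n} (σ : VSet m n) → IsFace σ ⇔ T (face σ)
face-⇔ (lx , ly , e) = ⇔-trans
  (⇔-sym T-not-≡
     ×-⇔ viaT (loopFree-⇔ {G = e ∘ suc})
     ×-⇔ viaT (⇔-trans (mk⇔ (λ h j i → h i j) (λ h i j → h j i)) (loopFree-⇔ {G = λ j i → e i (suc j)}))
     ×-⇔ viaT (mk⇔ (chain-complete {e = e}) chain-sound))
  (⇔-sym (⇔-trans T-∧ (⇔-refl ×-⇔ ⇔-trans T-∧ (⇔-refl ×-⇔ T-∧))))
  where
  viaT : ∀ {p} {A : Set p} {b} → A ⇔ (b ≡ true) → A ⇔ T b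
  viaT A⇔b = ⇔-trans A⇔b (⇔-sym T-≡)

face-does : ∀ {m n} (σ : VSet m n) → does (isFace? σ) ≡ face σ
face-does σ = does-⇔ (face-⇔ σ) (isFace? σ) (T? (face σ))

module ListSums {c ℓ} (R : CommutativeSemiring c ℓ) where
  open CommutativeSemiring R hiding (zero)
  open import Algebra.Properties.CommutativeSemigroup +-commutativeSemigroup
    using () renaming (interchange to +-interchange)
  open import Relation.Binary.Reasoning.Setoid setoid

  private variable
    a b : Level
    A : Set a
    B : Set b

  ∑ : (A → Carrier) → List A → Carrier
  ∑ = Σ-list R

  ∑-cong : ∀ {f g : A → Carrier} xs → (∀ x → f x ≈ g x) → ∑ f xs ≈ ∑ g xs
  ∑-cong []       f≈g = refl
  ∑-cong (x ∷ xs) f≈g = +-cong (f≈g x) (∑-cong xs f≈g)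

  ∑-++ : ∀ (f : A → Carrier) xs ys → ∑ f (xs ++ ys) ≈ ∑ f xs + ∑ f ys
  ∑-++ f []       ys = sym (+-identityˡ _)
  ∑-++ f (x ∷ xs) ys = trans (+-congˡ (∑-++ f xs ys)) (sym (+-assoc _ _ _))

  ∑-concatMap : ∀ (f : B → Carrier) (h : A → List B) xs →
    ∑ f (concatMap h xs) ≈ ∑ (λ x → ∑ f (h x)) xs
  ∑-concatMap f h []       = refl
  ∑-concatMap f h (x ∷ xs) = trans (∑-++ f (h x) (concatMap h xs)) (+-congˡ (∑-concatMap f h xs))

  ∑-map : ∀ (f : B → Carrier) (h : A → B) xs → ∑ f (map h xs) ≡ ∑ (f ∘ h) xs
  ∑-map f h []       = ≡.refl
  ∑-map f h (x ∷ xs) = ≡.cong (f (h x) +_) (∑-map f h xs)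

  ∑-0 : ∀ (xs : List A) → ∑ (λ _ → 0#) xs ≈ 0#
  ∑-0 []       = refl
  ∑-0 (x ∷ xs) = trans (+-identityˡ _) (∑-0 xs)

  ∑-+ : ∀ (f g : A → Carrier) xs → ∑ (λ x → f x + g x) xs ≈ ∑ f xs + ∑ g xs
  ∑-+ f g []       = sym (+-identityˡ _)
  ∑-+ f g (x ∷ xs) = trans (+-congˡ (∑-+ f g xs)) (+-interchange _ _ _ _)

  ∑-*ˡ : ∀ k (f : A → Carrier) xs → ∑ (λ x → k * f x) xs ≈ k * ∑ f xs
  ∑-*ˡ k f []       = sym (zeroʳ k)
  ∑-*ˡ k f (x ∷ xs) = trans (+-congˡ (∑-*ˡ k f xs)) (sym (distribˡ k _ _))

  ∑-*ʳ : ∀ k (f : A → Carrier) xs → ∑ (λ x → f x * k) xs ≈ ∑ f xs * k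
  ∑-*ʳ k f xs = trans (∑-cong xs λ x → *-comm (f x) k) (trans (∑-*ˡ k f xs) (*-comm k _))

  ∑-comm : ∀ (f : A → B → Carrier) xs ys →
    ∑ (λ x → ∑ (f x) ys) xs ≈ ∑ (λ y → ∑ (λ x → f x y) xs) ys
  ∑-comm f []       ys = sym (∑-0 ys)
  ∑-comm f (x ∷ xs) ys = trans (+-congˡ (∑-comm f xs ys)) (sym (∑-+ (f x) _ ys))

  -- funs conses with its own pattern lambda rather than V._∷_; F must not tell them apart, which
  -- holds by refl whenever F only looks at h zero and h ∘ suc.
  ∑-funs-suc : ∀ {k} (F : (Fin (suc k) → A) → Carrier) xs → (∀ h → F h ≈ F (h zero V.∷ h ∘ suc)) →
    ∑ F (funs (suc k) xs) ≈ ∑ (λ x → ∑ (λ g → F (x V.∷ g)) (funs k xs)) xs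
  ∑-funs-suc {k = k} F xs F-cons = trans (∑-concatMap F _ xs)
    (∑-cong xs λ x → trans (reflexive (∑-map F _ (funs k xs))) (∑-cong (funs k xs) λ g → F-cons _))

  ∑-∑-*ˡ : ∀ a (f : A → Carrier) (g : B → Carrier) xs ys →
    ∑ (λ x → ∑ (λ y → a * (f x * g y)) ys) xs ≈ a * (∑ f xs * ∑ g ys)
  ∑-∑-*ˡ a f g xs ys = begin
    ∑ (λ x → ∑ (λ y → a * (f x * g y)) ys) xs ≈⟨ ∑-cong xs (λ x → trans (∑-*ˡ a _ ys) (*-congˡ (∑-*ˡ (f x) g ys))) ⟩
    ∑ (λ x → a * (f x * ∑ g ys)) xs           ≈⟨ trans (∑-*ˡ a _ xs) (*-congˡ (∑-*ʳ (∑ g ys) f xs)) ⟩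
    a * (∑ f xs * ∑ g ys)                     ∎

  ind : Bool → Carrier
  ind b = if b then 1# else 0#

  ind-∧ : ∀ a b → ind (a ∧ b) ≈ ind a * ind b
  ind-∧ true  b = sym (*-identityˡ _)
  ind-∧ false b = sym (zeroˡ _)

  ind-guard : ∀ b {x y} → (b ≡ true → x ≈ y) → ind b * x ≈ ind b * y
  ind-guard true  x≈y = *-congˡ (x≈y ≡.refl)
  ind-guard false _   = trans (zeroˡ _) (sym (zeroˡ _))

  ∑-filter : ∀ {p} {P : A → Set p} (P? : Decidable P) (f : A → Carrier) xs →
    ∑ f (filter P? xs) ≈ ∑ (λ x → ind (does (P? x)) * f x) xs
  ∑-filter P? f []       = refl
  ∑-filter P? f (x ∷ xs) with does (P? x)
  ... | true  = +-cong (sym (*-identityˡ _)) (∑-filter P? f xs)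
  ... | false = trans (∑-filter P? f xs) (sym (trans (+-congʳ (zeroˡ _)) (+-identityˡ _)))

m+n∸2a≡[m∸a]+[n∸a] : ∀ a m n → a ℕ.≤ m → a ℕ.≤ n → m ℕ.+ n ∸ 2 ℕ.* a ≡ (m ∸ a) ℕ.+ (n ∸ a)
m+n∸2a≡[m∸a]+[n∸a] zero    m       n       _         _         = ≡.refl
m+n∸2a≡[m∸a]+[n∸a] (suc a) (suc m) (suc n) (s≤s a≤m) (s≤s a≤n) = begin
  suc m ℕ.+ suc n ∸ 2 ℕ.* suc a         ≡⟨ ≡.cong₂ (λ x y → suc x ∸ y) (ℕ.+-suc m n) (ℕ.*-suc 2 a) ⟩
  suc (suc (m ℕ.+ n)) ∸ (2 ℕ.+ 2 ℕ.* a) ≡⟨ m+n∸2a≡[m∸a]+[n∸a] a m n a≤m a≤n ⟩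
  (m ∸ a) ℕ.+ (n ∸ a)                   ∎
  where open ≡.≡-Reasoning

module Recurrence {c ℓ} (R : CommutativeSemiring c ℓ) (q t : CommutativeSemiring.Carrier R) where
  open CommutativeSemiring R hiding (zero)
  open RS rawSemiring using (_^_)
  open import Relation.Binary.Reasoning.Setoid setoid
  open import Algebra.Solver.Ring.NaturalCoefficients.Default R

  u w r : Carrier
  u = t + 1#
  w = q + t + 1#
  r = q * (q + 1#)

  ahead : ℕ → (ℕ → Carrier) → Carrier
  ahead zero    χ = 0#
  ahead (suc p) χ = χ 1 + w * ahead p (χ ∘ suc)

  ahead-cong : ∀ p {χ χ′ : ℕ → Carrier} → (∀ d → d ℕ.< p → χ (suc d) ≈ χ′ (suc d)) → ahead p χ ≈ ahead p χ′
  ahead-cong zero    χ≈χ′ = refl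
  ahead-cong (suc p) χ≈χ′ = +-cong (χ≈χ′ 0 (s≤s z≤n)) (*-congˡ (ahead-cong p λ d d<p → χ≈χ′ (suc d) (s≤s d<p)))

  ahead-+ : ∀ p (χ χ′ : ℕ → Carrier) → ahead p (λ d → χ d + χ′ d) ≈ ahead p χ + ahead p χ′
  ahead-+ zero    χ χ′ = sym (+-identityʳ 0#)
  ahead-+ (suc p) χ χ′ = trans (+-congˡ (*-congˡ (ahead-+ p (χ ∘ suc) (χ′ ∘ suc))))
    (solve 5 (λ a b c d e → (a :+ b) :+ c :* (d :+ e) := (a :+ c :* d) :+ (b :+ c :* e)) refl
      (χ 1) (χ′ 1) w (ahead p (χ ∘ suc)) (ahead p (χ′ ∘ suc)))

  ahead-*ˡ : ∀ p a (χ : ℕ → Carrier) → ahead p (λ d → a * χ d) ≈ a * ahead p χ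
  ahead-*ˡ zero    a χ = sym (zeroʳ a)
  ahead-*ˡ (suc p) a χ = trans (+-congˡ (*-congˡ (ahead-*ˡ p a (χ ∘ suc))))
    (solve 4 (λ a b c d → a :* b :+ c :* (a :* d) := a :* (b :+ c :* d)) refl a (χ 1) w (ahead p (χ ∘ suc)))

  -- conv ψ p = Σ_{j<p} w^(p-1-j) ψ j; written through ahead, conv ψ (suc p) reduces to ψ p + w * conv ψ p.
  conv : (ℕ → Carrier) → ℕ → Carrier
  conv ψ p = ahead p (λ d → ψ (p ∸ d))

  conv-+ : ∀ (ψ χ : ℕ → Carrier) p → conv (λ p → ψ p + χ p) p ≈ conv ψ p + conv χ p
  conv-+ ψ χ p = ahead-+ p (λ d → ψ (p ∸ d)) (λ d → χ (p ∸ d))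

  conv-*ˡ : ∀ a (ψ : ℕ → Carrier) p → conv (λ p → a * ψ p) p ≈ a * conv ψ p
  conv-*ˡ a ψ p = ahead-*ˡ p a (λ d → ψ (p ∸ d))

  step : (ℕ → Carrier) → ℕ → Carrier
  step ψ p = w * ψ p + r * conv ψ p

  step-cong : ∀ {ψ ψ′ : ℕ → Carrier} → (∀ p → ψ p ≈ ψ′ p) → ∀ p → step ψ p ≈ step ψ′ p
  step-cong ψ≈ψ′ p = +-cong (*-congˡ (ψ≈ψ′ p)) (*-congˡ (ahead-cong p λ d _ → ψ≈ψ′ (p ∸ suc d)))

  fold-cong : ∀ {ψ ψ′ : ℕ → Carrier} → (∀ p → ψ p ≈ ψ′ p) → ∀ k p → fold ψ step k p ≈ fold ψ′ step k p
  fold-cong ψ≈ψ′ zero    = ψ≈ψ′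
  fold-cong ψ≈ψ′ (suc k) = step-cong (fold-cong ψ≈ψ′ k)

  row₀ : (ℕ → Carrier) → ℕ → Carrier
  row₀ ψ p = ψ p + q * conv ψ p

  row₀-step : ∀ ψ p → row₀ (step ψ) p ≈ step (row₀ ψ) p
  row₀-step ψ p = begin
    (w * ψ p + r * cψ) + q * conv (step ψ) p    ≈⟨ +-congˡ (*-congˡ conv-step) ⟩
    (w * ψ p + r * cψ) + q * (w * cψ + r * ccψ)
      ≈⟨ solve 6 (λ w r q x c cc → (w :* x :+ r :* c) :+ q :* (w :* c :+ r :* cc) :=
                                   w :* (x :+ q :* c) :+ r :* (c :+ q :* cc)) refl w r q (ψ p) cψ ccψ ⟩
    w * row₀ ψ p + r * (cψ + q * ccψ)           ≈⟨ +-congˡ (*-congˡ (sym conv-row₀)) ⟩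
    step (row₀ ψ) p                             ∎
    where
    cψ = conv ψ p
    ccψ = conv (conv ψ) p
    conv-step : conv (step ψ) p ≈ w * cψ + r * ccψ
    conv-step = trans (conv-+ (λ p → w * ψ p) (λ p → r * conv ψ p) p) (+-cong (conv-*ˡ w ψ p) (conv-*ˡ r (conv ψ) p))
    conv-row₀ : conv (row₀ ψ) p ≈ cψ + q * ccψ
    conv-row₀ = trans (conv-+ ψ (λ p → q * conv ψ p) p) (+-congˡ (conv-*ˡ q (conv ψ) p))

  fold-row₀ : ∀ ψ k p → fold (row₀ ψ) step k p ≈ row₀ (fold ψ step k) p
  fold-row₀ ψ zero    p = refl
  fold-row₀ ψ (suc k) p = trans (step-cong (fold-row₀ ψ k) p) (sym (row₀-step (fold ψ step k) p))

  row₀-u^ : ∀ p → row₀ (u ^_) p ≈ w ^ p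
  row₀-u^ zero    = trans (+-congˡ (zeroʳ q)) (+-identityʳ 1#)
  row₀-u^ (suc p) = begin
    u * u ^ p + q * (u ^ p + w * conv (u ^_) p)
      ≈⟨ solve 4 (λ q t x c → (t :+ con 1) :* x :+ q :* (x :+ (q :+ t :+ con 1) :* c) :=
                               (q :+ t :+ con 1) :* (x :+ q :* c)) refl q t (u ^ p) (conv (u ^_) p) ⟩
    w * row₀ (u ^_) p ≈⟨ *-congˡ (row₀-u^ p) ⟩
    w * w ^ p         ∎

module Binomial {c ℓ} (R : CommutativeSemiring c ℓ) (q t : CommutativeSemiring.Carrier R) where
  open CommutativeSemiring R hiding (zero)
  open RS rawSemiring using (_^_) renaming (_×_ to _·_)
  open Recurrence R q t using (w; r; conv; step; step-cong)
  open import Relation.Binary.Reasoning.Setoid setoid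
  open import Algebra.Solver.Ring.NaturalCoefficients.Default R
  open import Algebra.Properties.Semiring.Sum semiring
    using (sum; sum-cong-≋; ∑-distrib-+; *-distribˡ-sum; sum-replicate-zero)
  open import Algebra.Properties.Semiring.Mult semiring using (×-homo-+; ×-comm-*; ×-congʳ)
  open import Algebra.Properties.CommutativeSemigroup *-commutativeSemigroup using (x∙yz≈y∙xz)
  open import Algebra.Properties.CommutativeSemiring.Exp R using (^-distrib-*)

  ∑ℕ : ℕ → (ℕ → Carrier) → Carrier
  ∑ℕ n f = sum {n} (f ∘ toℕ)

  ∑ℕ-cong : ∀ n {f g : ℕ → Carrier} → (∀ a → f a ≈ g a) → ∑ℕ n f ≈ ∑ℕ n g
  ∑ℕ-cong n f≈g = sum-cong-≋ {n} (f≈g ∘ toℕ)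

  ∑ℕ-+ : ∀ n (f g : ℕ → Carrier) → ∑ℕ n (λ a → f a + g a) ≈ ∑ℕ n f + ∑ℕ n g
  ∑ℕ-+ n f g = ∑-distrib-+ {n} (f ∘ toℕ) (g ∘ toℕ)

  ∑ℕ-*ˡ : ∀ n x (f : ℕ → Carrier) → ∑ℕ n (λ a → x * f a) ≈ x * ∑ℕ n f
  ∑ℕ-*ˡ n x f = sym (*-distribˡ-sum {n} x (f ∘ toℕ))

  ∑ℕ-extend : ∀ {n n′} {f g : ℕ → Carrier} → n ℕ.≤ n′ →
    (∀ a → a ℕ.< n → f a ≈ g a) → (∀ a → n ℕ.≤ a → g a ≈ 0#) → ∑ℕ n f ≈ ∑ℕ n′ g
  ∑ℕ-extend {zero} {n′} {g = g} _ _ g≈0 = sym (trans (∑ℕ-cong n′ λ a → g≈0 a z≤n) (sum-replicate-zero n′))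
  ∑ℕ-extend {suc n} {suc n′} (s≤s n≤n′) f≈g g≈0 = +-cong (f≈g 0 (s≤s z≤n))
    (∑ℕ-extend n≤n′ (λ a a<n → f≈g (suc a) (s≤s a<n)) (λ a n≤a → g≈0 (suc a) (s≤s n≤a)))

  Σ-list-applyUpTo : ∀ (f : ℕ → Carrier) g n → Σ-list R f (applyUpTo g n) ≡ ∑ℕ n (f ∘ g)
  Σ-list-applyUpTo f g zero    = ≡.refl
  Σ-list-applyUpTo f g (suc n) = ≡.cong (f (g 0) +_) (Σ-list-applyUpTo f (g ∘ suc) n)

  binomialTerm : ℕ → ℕ → ℕ → Carrier
  binomialTerm k p a = ((k C a) ℕ.* (p C a)) · (r ^ a * w ^ ((k ∸ a) ℕ.+ (p ∸ a)))

  binomialSum : ℕ → ℕ → Carrier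
  binomialSum k p = ∑ℕ (suc k) (binomialTerm k p)

  -- Pascal's rule in k splits the terms of binomialSum (suc k) p into those of binomialSum k p and these.
  cross : ℕ → ℕ → ℕ → Carrier
  cross k p b = ((k C b) ℕ.* (p C suc b)) · (r ^ suc b * w ^ ((k ∸ b) ℕ.+ (p ∸ suc b)))

  crossSum : ℕ → ℕ → Carrier
  crossSum k p = ∑ℕ (suc k) (cross k p)

  ·-zero : ∀ {n} x → n ≡ 0 → n · x ≈ 0#
  ·-zero x ≡.refl = refl

  pull-w : ∀ n a e e′ → n ≡ 0 ⊎ e ≡ suc e′ → n · (r ^ a * w ^ e) ≈ w * (n · (r ^ a * w ^ e′))
  pull-w n a e e′ (inj₁ n≡0)    = trans (·-zero _ n≡0) (sym (trans (*-congˡ (·-zero _ n≡0)) (zeroʳ w)))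
  pull-w n a e e′ (inj₂ ≡.refl) =
    trans (×-congʳ n (x∙yz≈y∙xz (r ^ a) w (w ^ e′))) (sym (×-comm-* n w (r ^ a * w ^ e′)))

  C≡0-or-∸≡suc : ∀ n b → n C suc b ≡ 0 ⊎ n ∸ b ≡ suc (n ∸ suc b)
  C≡0-or-∸≡suc n b with suc b ℕ.≤? n
  ... | yes b<n = inj₂ (ℕ.+-∸-assoc 1 b<n)
  ... | no  b≮n = inj₁ (k>n⇒nCk≡0 (ℕ.≰⇒> b≮n))

  binomialTerm-pascal : ∀ k p b → binomialTerm (suc k) p (suc b) ≈ cross k p b + w * binomialTerm k p (suc b)
  binomialTerm-pascal k p b = begin
    ((suc k C suc b) ℕ.* (p C suc b)) · X
      ≡⟨ ≡.cong (λ c → (c ℕ.* (p C suc b)) · X) (≡.sym (nCk+nC[k+1]≡[n+1]C[k+1] k b)) ⟩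
    ((k C b ℕ.+ k C suc b) ℕ.* (p C suc b)) · X
      ≡⟨ ≡.cong (_· X) (ℕ.*-distribʳ-+ (p C suc b) (k C b) (k C suc b)) ⟩
    ((k C b) ℕ.* (p C suc b) ℕ.+ (k C suc b) ℕ.* (p C suc b)) · X
      ≈⟨ ×-homo-+ X ((k C b) ℕ.* (p C suc b)) _ ⟩
    cross k p b + ((k C suc b) ℕ.* (p C suc b)) · X
      ≈⟨ +-congˡ (pull-w _ (suc b) _ _ zero-or-shift) ⟩
    cross k p b + w * binomialTerm k p (suc b) ∎
    where
    X = r ^ suc b * w ^ ((k ∸ b) ℕ.+ (p ∸ suc b))
    zero-or-shift : (k C suc b) ℕ.* (p C suc b) ≡ 0 ⊎ (k ∸ b) ℕ.+ (p ∸ suc b) ≡ suc ((k ∸ suc b) ℕ.+ (p ∸ suc b))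
    zero-or-shift = Sum.map (≡.cong (ℕ._* (p C suc b))) (≡.cong (ℕ._+ (p ∸ suc b))) (C≡0-or-∸≡suc k b)

  cross-pascal : ∀ k p b → cross k (suc p) b ≈ r * binomialTerm k p b + w * cross k p b
  cross-pascal k p b = begin
    ((k C b) ℕ.* (suc p C suc b)) · X
      ≡⟨ ≡.cong (λ c → ((k C b) ℕ.* c) · X) (≡.sym (nCk+nC[k+1]≡[n+1]C[k+1] p b)) ⟩
    ((k C b) ℕ.* (p C b ℕ.+ p C suc b)) · X
      ≡⟨ ≡.cong (_· X) (ℕ.*-distribˡ-+ (k C b) (p C b) (p C suc b)) ⟩
    ((k C b) ℕ.* (p C b) ℕ.+ (k C b) ℕ.* (p C suc b)) · X
      ≈⟨ ×-homo-+ X ((k C b) ℕ.* (p C b)) _ ⟩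
    N · X + ((k C b) ℕ.* (p C suc b)) · X
      ≈⟨ +-cong (trans (×-congʳ N (*-assoc r (r ^ b) E)) (sym (×-comm-* N r (r ^ b * E))))
                (pull-w _ (suc b) _ _ zero-or-shift) ⟩
    r * binomialTerm k p b + w * cross k p b ∎
    where
    N = (k C b) ℕ.* (p C b)
    E = w ^ ((k ∸ b) ℕ.+ (p ∸ b))
    X = r ^ suc b * E
    zero-or-shift : (k C b) ℕ.* (p C suc b) ≡ 0 ⊎ (k ∸ b) ℕ.+ (p ∸ b) ≡ suc ((k ∸ b) ℕ.+ (p ∸ suc b))
    zero-or-shift = Sum.map (λ C≡0 → ≡.trans (≡.cong ((k C b) ℕ.*_) C≡0) (ℕ.*-zeroʳ (k C b)))
                            (λ eq → ≡.trans (≡.cong ((k ∸ b) ℕ.+_) eq) (ℕ.+-suc (k ∸ b) _))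
                            (C≡0-or-∸≡suc p b)

  binomialSum-suc : ∀ k p → binomialSum (suc k) p ≈ w * binomialSum k p + crossSum k p
  binomialSum-suc k p = begin
    binomialTerm (suc k) p 0 + ∑ℕ (suc k) (λ b → binomialTerm (suc k) p (suc b))
      ≈⟨ +-cong (pull-w 1 0 (suc k ℕ.+ p) (k ℕ.+ p) (inj₂ ≡.refl))
                (trans (∑ℕ-cong (suc k) (binomialTerm-pascal k p))
                       (∑ℕ-+ (suc k) (cross k p) (λ b → w * binomialTerm k p (suc b)))) ⟩
    w * binomialTerm k p 0 + (crossSum k p + ∑ℕ (suc k) (λ b → w * binomialTerm k p (suc b)))
      ≈⟨ +-congˡ (+-congˡ (trans (∑ℕ-*ˡ (suc k) w (binomialTerm k p ∘ suc)) (*-congˡ drop-last))) ⟩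
    w * binomialTerm k p 0 + (crossSum k p + w * ∑ℕ k (binomialTerm k p ∘ suc))
      ≈⟨ solve 4 (λ w a c s → w :* a :+ (c :+ w :* s) := w :* (a :+ s) :+ c) refl w _ (crossSum k p) _ ⟩
    w * binomialSum k p + crossSum k p ∎
    where
    beyond-k : ∀ b → k ℕ.≤ b → binomialTerm k p (suc b) ≈ 0#
    beyond-k b k≤b = ·-zero _ (≡.cong (ℕ._* (p C suc b)) (k>n⇒nCk≡0 (s≤s k≤b)))
    drop-last : ∑ℕ (suc k) (binomialTerm k p ∘ suc) ≈ ∑ℕ k (binomialTerm k p ∘ suc)
    drop-last = sym (∑ℕ-extend {f = binomialTerm k p ∘ suc} (ℕ.n≤1+n k) (λ _ _ → refl) beyond-k)

  crossSum-conv : ∀ k p → crossSum k p ≈ r * conv (binomialSum k) p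
  crossSum-conv k zero = begin
    crossSum k 0          ≈⟨ ∑ℕ-cong (suc k) (λ b → ·-zero (r ^ suc b * w ^ ((k ∸ b) ℕ.+ 0)) (ℕ.*-zeroʳ (k C b))) ⟩
    ∑ℕ (suc k) (λ _ → 0#) ≈⟨ sum-replicate-zero (suc k) ⟩
    0#                    ≈⟨ sym (zeroʳ r) ⟩
    r * 0#                ∎
  crossSum-conv k (suc p) = begin
    crossSum k (suc p)
      ≈⟨ trans (∑ℕ-cong (suc k) (cross-pascal k p))
               (∑ℕ-+ (suc k) (λ b → r * binomialTerm k p b) (λ b → w * cross k p b)) ⟩
    ∑ℕ (suc k) (λ b → r * binomialTerm k p b) + ∑ℕ (suc k) (λ b → w * cross k p b)
      ≈⟨ +-cong (∑ℕ-*ˡ (suc k) r (binomialTerm k p))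
                (trans (∑ℕ-*ˡ (suc k) w (cross k p)) (*-congˡ (crossSum-conv k p))) ⟩
    r * binomialSum k p + w * (r * conv (binomialSum k) p)
      ≈⟨ solve 4 (λ r w b c → r :* b :+ w :* (r :* c) := r :* (b :+ w :* c)) refl r w _ _ ⟩
    r * conv (binomialSum k) (suc p) ∎

  binomialSum≈fold : ∀ k p → binomialSum k p ≈ fold (w ^_) step k p
  binomialSum≈fold zero    p = trans (+-identityʳ _) (trans (+-identityʳ _) (*-identityˡ _))
  binomialSum≈fold (suc k) p = begin
    binomialSum (suc k) p              ≈⟨ binomialSum-suc k p ⟩
    w * binomialSum k p + crossSum k p ≈⟨ +-congˡ (crossSum-conv k p) ⟩
    step (binomialSum k) p             ≈⟨ step-cong (binomialSum≈fold k) p ⟩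
    fold (w ^_) step (suc k) p         ∎

  formula≈binomialSum : ∀ m n → F-formula R m n q t ≈ binomialSum m n
  formula≈binomialSum m n = trans (reflexive (Σ-list-applyUpTo _ (λ a → a) (suc (m ⊓ n))))
    (∑ℕ-extend (s≤s (ℕ.m⊓n≤m m n)) same beyond)
    where
    same : ∀ a → a ℕ.< suc (m ⊓ n) → _ ≈ binomialTerm m n a
    same a (s≤s a≤m⊓n) = ×-congʳ ((m C a) ℕ.* (n C a)) (*-cong (sym (^-distrib-* q (q + 1#) a))
      (reflexive (≡.cong (w ^_) (m+n∸2a≡[m∸a]+[n∸a] a m n (ℕ.≤-trans a≤m⊓n (ℕ.m⊓n≤m m n))
                                                          (ℕ.≤-trans a≤m⊓n (ℕ.m⊓n≤n m n))))))
    beyond : ∀ a → suc (m ⊓ n) ℕ.≤ a → binomialTerm m n a ≈ 0#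
    beyond a m⊓n<a with ℕ.≤-total m n
    ... | inj₁ m≤n = ·-zero _ (≡.cong (ℕ._* (n C a)) (k>n⇒nCk≡0 (≡.subst (ℕ._< a) (ℕ.m≤n⇒m⊓n≡m m≤n) m⊓n<a)))
    ... | inj₂ n≤m = ·-zero _ (≡.trans (≡.cong ((m C a) ℕ.*_) (k>n⇒nCk≡0 (≡.subst (ℕ._< a) (ℕ.m≥n⇒m⊓n≡n n≤m) m⊓n<a)))
                                       (ℕ.*-zeroʳ (m C a)))

module Transfer {c ℓ} (R : CommutativeSemiring c ℓ) (q t : CommutativeSemiring.Carrier R) where
  open CommutativeSemiring R hiding (zero)
  open RS rawSemiring using (_^_)
  open ListSums R
  open Recurrence R q t using (u; w; r; ahead; ahead-cong; step)
  open import Relation.Binary.Reasoning.Setoid setoid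
  open import Algebra.Solver.Ring.NaturalCoefficients.Default R
  open import Algebra.Properties.Semiring.Exp semiring using (^-homo-*)
  open import Algebra.Properties.CommutativeMonoid.Sum *-commutativeMonoid using ()
    renaming (sum to ∏; sum-cong-≋ to ∏-cong; ∑-distrib-+ to ∏-distrib-*; sum-replicate-zero to ∏-1)
  open import Algebra.Solver.CommutativeMonoid ∧-commutativeMonoid
    using () renaming (solve to solveᵇ; _⊕_ to _⊕ᵇ_; _⊜_ to _⊜ᵇ_)

  -- A row or column (other than x₀, y₀) either meets an edge, or is free and may carry a loop.
  lineWeight : Bool → Carrier
  lineWeight covered = if covered then 1# else u

  module _ {N : ℕ} where

    -- the columns that a row x at threshold s closes to all later rows
    closedColumns : ℕ → (Fin N → Bool) → Carrier
    closedColumns s x = ∏ λ j → if (s ≤ᵇ toℕ j) ∧ (toℕ j <ᵇ next s x) then lineWeight (x j) else 1#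

    openColumns : ∀ {k} → ℕ → (Fin k → Fin N → Bool) → Carrier
    openColumns s g = ∏ λ j → if s ≤ᵇ toℕ j then lineWeight (column g j) else 1#

    stepWeight : ℕ → (Fin N → Bool) → Carrier
    stepWeight s x = ind (allowed s x) * (q ^ size x * closedColumns s x)

    chainWeight : ∀ {k} → ℕ → (Fin k → Fin N → Bool) → Carrier
    chainWeight s g = ind (chain g ∧ above s g) * (q ^ edgeCount g * openColumns s g)

  rowWeights : ∀ {k N} → (Fin k → Fin N → Bool) → Carrier
  rowWeights g = ∏ λ i → lineWeight (any (g i))

  -- k rows after a row with top s: the columns j < s are no longer open, and column s - 1 is covered.
  block : ∀ N → ℕ → ℕ → Carrier
  block N k s = ∑ (λ g → chainWeight s g * rowWeights g) (funs k (funs N bools))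

  rowTerm : ∀ {N} → ℕ → (ℕ → Carrier) → (Fin N → Bool) → Carrier
  rowTerm s φ x = (stepWeight s x * lineWeight (any x)) * φ (next s x)

  rowSum : ∀ N → ℕ → (ℕ → Carrier) → Carrier
  rowSum N s φ = ∑ (rowTerm s φ) (funs N bools)

  -- Later rows meet a column j < next s x only if j is the last column of x, which x covers anyway,
  -- and x meets no column j ≥ next s x.
  openColumns-split : ∀ {k N} s (x : Fin N → Bool) (g : Fin k → Fin N → Bool) → above (next s x) g ≡ true →
    openColumns s (x V.∷ g) ≈ closedColumns s x * openColumns (next s x) g
  openColumns-split {N = N} s x g ab = trans (∏-cong {N} column-split) (∏-distrib-* {N} _ _)
    where
    n = next s x
    row-covers : ∀ {j} → s ℕ.≤ toℕ j → toℕ j ℕ.< n → x j ∨ column g j ≡ x j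
    row-covers {j} s≤j j<n with x j in xj | column g j in cj
    ... | true  | _     = ≡.refl
    ... | false | false = ≡.refl
    ... | false | true  = contradiction (≡.trans (≡.sym xj) (top-true x j top≡)) λ ()
      where
      n≡ : n ≡ suc (toℕ j)
      n≡ = ℕ.≤-antisym (column-bound {g = g} ab j cj) j<n
      top≡ : top x ≡ suc (toℕ j)
      top≡ with ℕ.⊔-sel s (top x)
      ... | inj₁ s⊔≡s = contradiction (ℕ.≤-trans (ℕ.≤-reflexive (≡.trans (≡.sym n≡) s⊔≡s)) s≤j) ℕ.1+n≰n
      ... | inj₂ s⊔≡top = ≡.trans (≡.sym s⊔≡top) n≡
    beyond-row : ∀ {j} → n ℕ.≤ toℕ j → x j ≡ false
    beyond-row {j} n≤j with x j in xj
    ... | false = ≡.refl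
    ... | true  = contradiction (ℕ.≤-trans (top-upper x j xj) (ℕ.≤-trans (ℕ.m≤n⊔m s (top x)) n≤j)) ℕ.1+n≰n
    column-split : ∀ j →
      (if s ≤ᵇ toℕ j then lineWeight (x j ∨ column g j) else 1#) ≈
      (if (s ≤ᵇ toℕ j) ∧ (toℕ j <ᵇ n) then lineWeight (x j) else 1#) *
      (if n ≤ᵇ toℕ j then lineWeight (column g j) else 1#)
    column-split j with s ≤ᵇ toℕ j in s≤j
    ... | false rewrite ≰⇒≤ᵇ≡false {n} {toℕ j} (≤ᵇ≡false⇒≰ s≤j ∘ ℕ.≤-trans (ℕ.m≤m⊔n s (top x))) =
      sym (*-identityˡ 1#)
    ... | true with toℕ j <ᵇ n in j<n
    ...   | true  rewrite ≰⇒≤ᵇ≡false {n} {toℕ j} (ℕ.<⇒≱ (≤ᵇ≡true⇒≤ j<n))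
                        | row-covers (≤ᵇ≡true⇒≤ s≤j) (≤ᵇ≡true⇒≤ j<n) = sym (*-identityʳ _)
    ...   | false rewrite ≤⇒≤ᵇ≡true {n} {toℕ j} (ℕ.≮⇒≥ (≤ᵇ≡false⇒≰ j<n))
                        | beyond-row (ℕ.≮⇒≥ (≤ᵇ≡false⇒≰ j<n)) = sym (*-identityˡ _)

  chainWeight-cons : ∀ {k N} s (x : Fin N → Bool) (g : Fin k → Fin N → Bool) →
    chainWeight s (x V.∷ g) ≈ stepWeight s x * chainWeight (next s x) g
  chainWeight-cons s x g = begin
    ind ((above (top x) g ∧ chain g) ∧ (allowed s x ∧ above s g)) * (q ^ (size x ℕ.+ edgeCount g) * O)
      ≡⟨ ≡.cong (λ b → ind b * (q ^ (size x ℕ.+ edgeCount g) * O)) conditions ⟩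
    ind (allowed s x ∧ ρ) * (q ^ (size x ℕ.+ edgeCount g) * O)
      ≈⟨ *-cong (ind-∧ (allowed s x) ρ) (*-congʳ (^-homo-* q (size x) (edgeCount g))) ⟩
    (ind (allowed s x) * ind ρ) * ((q ^ size x * q ^ edgeCount g) * O)
      ≈⟨ solve 5 (λ a b c d e → (a :* b) :* ((c :* d) :* e) := (a :* c) :* (d :* (b :* e))) refl
           (ind (allowed s x)) (ind ρ) (q ^ size x) (q ^ edgeCount g) O ⟩
    (ind (allowed s x) * q ^ size x) * (q ^ edgeCount g * (ind ρ * O))
      ≈⟨ *-congˡ (*-congˡ (ind-guard ρ λ ρ≡true → openColumns-split s x g (∧-conicalʳ _ _ ρ≡true))) ⟩
    (ind (allowed s x) * q ^ size x) * (q ^ edgeCount g * (ind ρ * (closedColumns s x * O′)))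
      ≈⟨ solve 6 (λ a c d b e f → (a :* c) :* (d :* (b :* (e :* f))) := (a :* (c :* e)) :* (b :* (d :* f))) refl
           (ind (allowed s x)) (q ^ size x) (q ^ edgeCount g) (ind ρ) (closedColumns s x) O′ ⟩
    stepWeight s x * chainWeight (next s x) g ∎
    where
    O = openColumns s (x V.∷ g)
    O′ = openColumns (next s x) g
    ρ = chain g ∧ above (next s x) g
    conditions : (above (top x) g ∧ chain g) ∧ (allowed s x ∧ above s g) ≡ allowed s x ∧ ρ
    conditions = ≡.trans
      (solveᵇ 4 (λ a b c d → (a ⊕ᵇ b) ⊕ᵇ (c ⊕ᵇ d) ⊜ᵇ c ⊕ᵇ (b ⊕ᵇ (d ⊕ᵇ a))) ≡.refl
        (above (top x) g) (chain g) (allowed s x) (above s g))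
      (≡.cong (λ b → allowed s x ∧ (chain g ∧ b)) (≡.sym (above-⊔ s (top x) g)))

  block-suc : ∀ N k s → block N (suc k) s ≈ rowSum N s (block N k)
  block-suc N k s = begin
    block N (suc k) s
      ≈⟨ ∑-funs-suc (λ e → chainWeight s e * rowWeights e) (funs N bools) (λ _ → refl) ⟩
    ∑ (λ x → ∑ (λ g → chainWeight s (x V.∷ g) * (lineWeight (any x) * rowWeights g)) G) (funs N bools)
      ≈⟨ ∑-cong (funs N bools) (λ x → trans (∑-cong G (λ g → peel x g)) (∑-*ˡ _ _ G)) ⟩
    rowSum N s (block N k) ∎
    where
    G = funs k (funs N bools)
    peel : ∀ x g → chainWeight s (x V.∷ g) * (lineWeight (any x) * rowWeights g) ≈
                   (stepWeight s x * lineWeight (any x)) * (chainWeight (next s x) g * rowWeights g)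
    peel x g = trans (*-congʳ (chainWeight-cons s x g))
      (solve 4 (λ a b c d → (a :* c) :* (b :* d) := (a :* b) :* (c :* d)) refl
        (stepWeight s x) (lineWeight (any x)) (chainWeight (next s x) g) (rowWeights g))

  block-zero : ∀ N s → block N 0 s ≈ u ^ (N ∸ s)
  block-zero N s = trans (solve 1 (λ x → (con 1 :* (con 1 :* x)) :* con 1 :+ con 0 := x) refl _) (free-columns N s)
    where
    free-columns : ∀ N s → ∏ {N} (λ j → if s ≤ᵇ toℕ j then u else 1#) ≈ u ^ (N ∸ s)
    free-columns zero    zero    = refl
    free-columns zero    (suc s) = refl
    free-columns (suc N) zero    = *-congˡ (free-columns N zero)
    free-columns (suc N) (suc s) = trans (*-identityˡ _)
      (trans (∏-cong {N} λ j → reflexive (≡.cong (λ b → if b then u else 1#) (<ᵇ-suc s (toℕ j)))) (free-columns N s))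

  prefixWeight : ∀ {N} → (Fin N → Bool) → Carrier
  prefixWeight x = q ^ size x * closedColumns 0 x

  prefixSum : ℕ → (ℕ → Carrier) → Carrier
  prefixSum N ψ = ∑ (λ x → prefixWeight x * ψ (top x)) (funs N bools)

  ∑-only-empty : ∀ N c → ∑ (λ x → if any x then 0# else c) (funs N bools) ≈ c
  ∑-only-empty zero    c = +-identityʳ c
  ∑-only-empty (suc N) c = begin
    ∑ (λ x → if any x then 0# else c) (funs (suc N) bools)
      ≈⟨ ∑-funs-suc {k = N} (λ x → if any x then 0# else c) bools (λ _ → refl) ⟩
    ∑ (λ x → if any x then 0# else c) (funs N bools) + (∑ (λ _ → 0#) (funs N bools) + 0#)
      ≈⟨ +-cong (∑-only-empty N c) (trans (+-identityʳ _) (∑-0 (funs N bools))) ⟩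
    c + 0# ≈⟨ +-identityʳ c ⟩
    c ∎

  closedColumns-cons : ∀ {N} s b (x : Fin N → Bool) → closedColumns (suc s) (b V.∷ x) ≈ closedColumns s x
  closedColumns-cons {N} s b x rewrite suc-⊔-top-step s b (top x) = trans (*-identityˡ _) (∏-cong {N} λ j →
    reflexive (≡.cong (λ c → if c ∧ (toℕ j <ᵇ next s x) then lineWeight (x j) else 1#) (<ᵇ-suc s (toℕ j))))

  prefixSum-eval : ∀ N ψ → prefixSum N ψ ≈ ψ 0 + q * ahead N ψ
  prefixSum-eval zero    ψ = solve 2 (λ a q → (con 1 :* con 1) :* a :+ con 0 := a :+ q :* con 0) refl (ψ 0) q
  prefixSum-eval (suc N) ψ = begin
    prefixSum (suc N) ψ
      ≈⟨ ∑-funs-suc {k = N} (λ x → prefixWeight x * ψ (top x)) bools (λ _ → refl) ⟩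
    ∑ (λ x → term (false V.∷ x)) X + (∑ (λ x → term (true V.∷ x)) X + 0#)
      ≈⟨ trans (+-congˡ (+-identityʳ _)) (sym (∑-+ _ _ X)) ⟩
    ∑ (λ x → term (false V.∷ x) + term (true V.∷ x)) X
      ≈⟨ ∑-cong X split ⟩
    ∑ (λ x → (if any x then 0# else ψ 0 + q * ψ 1) + w * (prefixWeight x * χ (top x))) X
      ≈⟨ trans (∑-+ _ _ X) (+-cong (∑-only-empty N _) (∑-*ˡ w _ X)) ⟩
    (ψ 0 + q * ψ 1) + w * prefixSum N χ
      ≈⟨ +-congˡ (*-congˡ (trans (prefixSum-eval N χ) (+-congˡ (*-congˡ (ahead-cong N λ _ _ → refl))))) ⟩
    (ψ 0 + q * ψ 1) + w * (0# + q * ahead N (ψ ∘ suc))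
      ≈⟨ solve 5 (λ a b q w c → (a :+ q :* b) :+ w :* (con 0 :+ q :* c) := a :+ q :* (b :+ w :* c)) refl
           (ψ 0) (ψ 1) q w (ahead N (ψ ∘ suc)) ⟩
    ψ 0 + q * ahead (suc N) ψ ∎
    where
    X = funs N bools
    term : (Fin (suc N) → Bool) → Carrier
    term x = prefixWeight x * ψ (top x)
    -- dropping the value at 0 leaves out the empty row, which is counted separately
    χ : ℕ → Carrier
    χ zero    = 0#
    χ (suc d) = ψ (suc (suc d))
    split : ∀ x → term (false V.∷ x) + term (true V.∷ x) ≈
                  (if any x then 0# else ψ 0 + q * ψ 1) + w * (prefixWeight x * χ (top x))
    split x with any x in some
    ... | true with nonempty-top x some
    ...   | a , top≡ rewrite top≡ =
      solve 5 (λ s c f q t → (s :* ((t :+ con 1) :* c)) :* f :+ ((q :* s) :* (con 1 :* c)) :* f :=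
                             con 0 :+ (q :+ t :+ con 1) :* ((s :* c) :* f)) refl
        (q ^ size x) _ (ψ (suc (suc a))) q t
    split x | false rewrite empty-size x some | empty-top x some = begin
      (1# * (1# * p)) * ψ 0 + ((q * 1#) * (1# * p)) * ψ 1
        ≈⟨ solve 4 (λ p a b q → (con 1 :* (con 1 :* p)) :* a :+ ((q :* con 1) :* (con 1 :* p)) :* b :=
                                p :* (a :+ q :* b) :+ con 0) refl p (ψ 0) (ψ 1) q ⟩
      p * (ψ 0 + q * ψ 1) + 0#
        ≈⟨ +-cong (trans (*-congʳ (∏-1 N)) (*-identityˡ _)) (sym (trans (*-congˡ (zeroʳ _)) (zeroʳ w))) ⟩
      (ψ 0 + q * ψ 1) + w * ((1# * p) * 0#) ∎
      where p = ∏ {N} λ _ → 1#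

  rowTerm-cons : ∀ {N} s φ b (x : Fin N → Bool) → rowTerm (suc s) φ (b V.∷ x) ≈
    (ind (allowed (suc s) (b V.∷ x)) * (q ^ size (b V.∷ x) * closedColumns s x)) * lineWeight (b ∨ any x)
      * φ (suc (next s x))
  rowTerm-cons s φ b x = *-cong (*-congʳ (*-congˡ (*-congˡ (closedColumns-cons s b x))))
                                (reflexive (≡.cong φ (suc-⊔-top-step s b (top x))))

  rowSum-shift : ∀ N s φ → rowSum (suc N) (suc (suc s)) φ ≈ rowSum N (suc s) (φ ∘ suc)
  rowSum-shift N s φ = begin
    rowSum (suc N) (suc (suc s)) φ
      ≈⟨ ∑-funs-suc {k = N} (rowTerm (suc (suc s)) φ) bools (λ _ → refl) ⟩
    ∑ (λ x → rowTerm (suc (suc s)) φ (false V.∷ x)) X + (∑ (λ x → rowTerm (suc (suc s)) φ (true V.∷ x)) X + 0#)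
      ≈⟨ +-cong (∑-cong X (rowTerm-cons (suc s) φ false))
                (trans (+-identityʳ _) (trans (∑-cong X forbidden) (∑-0 X))) ⟩
    rowSum N (suc s) (φ ∘ suc) + 0#
      ≈⟨ +-identityʳ _ ⟩
    rowSum N (suc s) (φ ∘ suc) ∎
    where
    X = funs N bools
    forbidden : ∀ x → rowTerm (suc (suc s)) φ (true V.∷ x) ≈ 0#
    forbidden x = trans (rowTerm-cons (suc s) φ true x)
      (solve 3 (λ a b c → ((con 0 :* a) :* b) :* c := con 0) refl _ _ _)

  rowSum-1 : ∀ N φ → rowSum (suc N) 1 φ ≈ w * φ 1 + r * ahead N (φ ∘ suc)
  rowSum-1 N φ = begin
    rowSum (suc N) 1 φ
      ≈⟨ ∑-funs-suc {k = N} (rowTerm 1 φ) bools (λ _ → refl) ⟩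
    ∑ (λ x → rowTerm 1 φ (false V.∷ x)) X + (∑ (λ x → rowTerm 1 φ (true V.∷ x)) X + 0#)
      ≈⟨ trans (+-congˡ (+-identityʳ _)) (sym (∑-+ _ _ X)) ⟩
    ∑ (λ x → rowTerm 1 φ (false V.∷ x) + rowTerm 1 φ (true V.∷ x)) X
      ≈⟨ ∑-cong X (λ x → trans (+-cong (rowTerm-1-cons false x) (rowTerm-1-cons true x)) (split x (any x) ≡.refl)) ⟩
    ∑ (λ x → (1# + q) * (prefixWeight x * φ (suc (top x))) + (if any x then 0# else t * φ 1)) X
      ≈⟨ trans (∑-+ _ _ X) (+-cong (∑-*ˡ (1# + q) _ X) (∑-only-empty N (t * φ 1))) ⟩
    (1# + q) * prefixSum N (φ ∘ suc) + t * φ 1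
      ≈⟨ +-congʳ (*-congˡ (prefixSum-eval N (φ ∘ suc))) ⟩
    (1# + q) * (φ 1 + q * ahead N (φ ∘ suc)) + t * φ 1
      ≈⟨ solve 4 (λ q t a c → (con 1 :+ q) :* (a :+ q :* c) :+ t :* a :=
                              (q :+ t :+ con 1) :* a :+ (q :* (q :+ con 1)) :* c) refl q t (φ 1) (ahead N (φ ∘ suc)) ⟩
    w * φ 1 + r * ahead N (φ ∘ suc) ∎
    where
    X = funs N bools
    rowTerm-1-cons : ∀ b (x : Fin N → Bool) → rowTerm 1 φ (b V.∷ x) ≈
      (q ^ size (b V.∷ x) * closedColumns 0 x) * lineWeight (b ∨ any x) * φ (suc (top x))
    rowTerm-1-cons b x = trans (rowTerm-cons 0 φ b x)
      (*-congʳ (*-congʳ (trans (*-congʳ (reflexive (≡.cong ind (allowed-1 (b V.∷ x))))) (*-identityˡ _))))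
    split : ∀ (x : Fin N → Bool) a → any x ≡ a →
      (q ^ size x * closedColumns 0 x) * lineWeight a * φ (suc (top x)) +
      ((q * q ^ size x) * closedColumns 0 x) * 1# * φ (suc (top x)) ≈
      (1# + q) * (prefixWeight x * φ (suc (top x))) + (if a then 0# else t * φ 1)
    split x true  _ = solve 4 (λ s c f q → (s :* c) :* con 1 :* f :+ ((q :* s) :* c) :* con 1 :* f :=
                                           (con 1 :+ q) :* ((s :* c) :* f) :+ con 0) refl _ _ _ q
    split x false none rewrite empty-size x none | empty-top x none = begin
      (1# * p) * (t + 1#) * φ 1 + ((q * 1#) * p) * 1# * φ 1
        ≈⟨ solve 4 (λ p f q t → (con 1 :* p) :* (t :+ con 1) :* f :+ ((q :* con 1) :* p) :* con 1 :* f :=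
                                (con 1 :+ q) :* ((con 1 :* p) :* f) :+ t :* (p :* f)) refl p (φ 1) q t ⟩
      (1# + q) * ((1# * p) * φ 1) + t * (p * φ 1)
        ≈⟨ +-congˡ (*-congˡ (trans (*-congʳ (∏-1 N)) (*-identityˡ _))) ⟩
      (1# + q) * ((1# * p) * φ 1) + t * φ 1 ∎
      where p = ∏ {N} λ _ → 1#

  rowSum-eval : ∀ N s φ → 1 ℕ.≤ s → s ℕ.≤ N → rowSum N s φ ≈ w * φ s + r * ahead (N ∸ s) (λ d → φ (s ℕ.+ d))
  rowSum-eval (suc N) 1             φ _ _         = rowSum-1 N φ
  rowSum-eval (suc N) (suc (suc s)) φ _ (s≤s s<N) =
    trans (rowSum-shift N s φ) (rowSum-eval N (suc s) (φ ∘ suc) (s≤s z≤n) s<N)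

  block≈fold : ∀ N k s → 1 ℕ.≤ s → s ℕ.≤ N → block N k s ≈ fold (u ^_) step k (N ∸ s)
  block≈fold N zero    s _   _   = block-zero N s
  block≈fold N (suc k) s 1≤s s≤N = begin
    block N (suc k) s
      ≈⟨ trans (block-suc N k s) (rowSum-eval N s (block N k) 1≤s s≤N) ⟩
    w * block N k s + r * ahead (N ∸ s) (λ d → block N k (s ℕ.+ d))
      ≈⟨ +-cong (*-congˡ (block≈fold N k s 1≤s s≤N)) (*-congˡ (ahead-cong (N ∸ s) further)) ⟩
    step (fold (u ^_) step k) (N ∸ s) ∎
    where
    further : ∀ d → d ℕ.< N ∸ s → block N k (s ℕ.+ suc d) ≈ fold (u ^_) step k ((N ∸ s) ∸ suc d)
    further d d<N∸s = trans
      (block≈fold N k (s ℕ.+ suc d) (ℕ.≤-trans 1≤s (ℕ.m≤m+n s (suc d)))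
        (ℕ.≤-trans (ℕ.+-monoʳ-≤ s d<N∸s) (ℕ.≤-reflexive (ℕ.m+[n∸m]≡n s≤N))))
      (reflexive (≡.cong (fold (u ^_) step k) (≡.sym (ℕ.∸-+-assoc N s (suc d)))))

  loopSum : ∀ {k} (U : Fin k → Bool) →
    ∑ (λ l → ind (all λ i → not (l i) ∨ not (U i)) * t ^ size l) (funs k bools) ≈ ∏ (lineWeight ∘ U)
  loopSum {zero}  U = trans (+-identityʳ _) (*-identityˡ 1#)
  loopSum {suc k} U = begin
    ∑ (λ l → ind (all λ i → not (l i) ∨ not (U i)) * t ^ size l) (funs (suc k) bools)
      ≈⟨ ∑-funs-suc {k = k} (λ l → ind (all λ i → not (l i) ∨ not (U i)) * t ^ size l) bools (λ _ → refl) ⟩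
    W + (∑ (λ l → ind (not (U zero) ∧ free l) * (t * t ^ size l)) L + 0#)
      ≈⟨ +-congˡ (trans (+-identityʳ _) (trans (∑-cong L loop-at-0) (trans (∑-*ˡ _ _ L) (*-congˡ (∑-*ˡ t _ L))))) ⟩
    W + ind (not (U zero)) * (t * W)
      ≈⟨ loop-or-not (U zero) ⟩
    lineWeight (U zero) * W
      ≈⟨ *-congˡ (loopSum (U ∘ suc)) ⟩
    ∏ (lineWeight ∘ U) ∎
    where
    L = funs k bools
    free : (Fin k → Bool) → Bool
    free l = all λ i → not (l i) ∨ not (U (suc i))
    W = ∑ (λ l → ind (free l) * t ^ size l) L
    loop-at-0 : ∀ l → ind (not (U zero) ∧ free l) * (t * t ^ size l) ≈
                      ind (not (U zero)) * (t * (ind (free l) * t ^ size l))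
    loop-at-0 l = trans (*-congʳ (ind-∧ (not (U zero)) (free l)))
      (solve 4 (λ a b t s → (a :* b) :* (t :* s) := a :* (t :* (b :* s))) refl _ _ t _)
    loop-or-not : ∀ b → W + ind (not b) * (t * W) ≈ lineWeight b * W
    loop-or-not true  = trans (+-congˡ (zeroˡ _)) (trans (+-identityʳ W) (sym (*-identityˡ W)))
    loop-or-not false = solve 2 (λ t a → a :+ con 1 :* (t :* a) := (t :+ con 1) :* a) refl t W

  edgeWeight : ∀ {m n} → (Fin (suc m) → Fin (suc n) → Bool) → Carrier
  edgeWeight e = ind (not (e zero zero)) * (chainWeight 1 e * rowWeights (e ∘ suc))

  F≈edgeSum : ∀ m n → F-triangle R m n q t ≈ ∑ edgeWeight (funs (suc m) (funs (suc n) bools))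
  F≈edgeSum m n = begin
    F-triangle R m n q t
      ≈⟨ ∑-filter isFace? _ (allVSets m n) ⟩
    ∑ Φ (allVSets m n)
      ≈⟨ unfold-allVSets ⟩
    ∑ (λ lx → ∑ (λ ly → ∑ (λ e → Φ (lx , ly , e)) Le) Ly) Lx
      ≈⟨ ∑-cong Lx (λ lx → ∑-cong Ly λ ly → ∑-cong Le λ e → factor lx ly e) ⟩
    ∑ (λ lx → ∑ (λ ly → ∑ (λ e → A e * (X lx e * Y ly e)) Le) Ly) Lx
      ≈⟨ trans (∑-cong Lx λ lx → ∑-comm _ Ly Le) (∑-comm _ Lx Le) ⟩
    ∑ (λ e → ∑ (λ lx → ∑ (λ ly → A e * (X lx e * Y ly e)) Ly) Lx) Le
      ≈⟨ ∑-cong Le sum-loops ⟩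
    ∑ edgeWeight Le ∎
    where
    Lx = funs m bools
    Ly = funs n bools
    Le = funs (suc m) (funs (suc n) bools)
    Φ : VSet m n → Carrier
    Φ σ = ind (does (isFace? σ)) * (q ^ #edges σ * t ^ #loops σ)
    A : (Fin (suc m) → Fin (suc n) → Bool) → Carrier
    A e = ind (not (e zero zero) ∧ chain e) * q ^ edgeCount e
    X : (Fin m → Bool) → (Fin (suc m) → Fin (suc n) → Bool) → Carrier
    X lx e = ind (loopFree (e ∘ suc) lx) * t ^ size lx
    Y : (Fin n → Bool) → (Fin (suc m) → Fin (suc n) → Bool) → Carrier
    Y ly e = ind (loopFree (λ j i → e i (suc j)) ly) * t ^ size ly

    unfold-allVSets : ∑ Φ (allVSets m n) ≈ ∑ (λ lx → ∑ (λ ly → ∑ (λ e → Φ (lx , ly , e)) Le) Ly) Lx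
    unfold-allVSets = trans (∑-concatMap Φ _ Lx) (∑-cong Lx λ lx →
      trans (∑-concatMap Φ _ Ly) (∑-cong Ly λ ly → reflexive (∑-map Φ _ Le)))

    factor : ∀ lx ly e → Φ (lx , ly , e) ≈ A e * (X lx e * Y ly e)
    factor lx ly e rewrite face-does (lx , ly , e) | #edges≡ lx ly e | #loops≡ lx ly e = begin
      ind (n₀ ∧ f₁ ∧ f₂ ∧ ch) * (q ^ edgeCount e * t ^ (size lx ℕ.+ size ly))
        ≈⟨ *-cong (trans (ind-∧ n₀ _) (*-congˡ (trans (ind-∧ f₁ _) (*-congˡ (ind-∧ f₂ ch)))))
                  (*-congˡ (^-homo-* t (size lx) (size ly))) ⟩
      (ind n₀ * (ind f₁ * (ind f₂ * ind ch))) * (q ^ edgeCount e * (t ^ size lx * t ^ size ly))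
        ≈⟨ solve 7 (λ a b c d e f g → (a :* (b :* (c :* d))) :* (e :* (f :* g)) :=
                                      ((a :* d) :* e) :* ((b :* f) :* (c :* g))) refl
             (ind n₀) (ind f₁) (ind f₂) (ind ch) (q ^ edgeCount e) (t ^ size lx) (t ^ size ly) ⟩
      ((ind n₀ * ind ch) * q ^ edgeCount e) * (X lx e * Y ly e)
        ≈⟨ *-congʳ (*-congʳ (sym (ind-∧ n₀ ch))) ⟩
      A e * (X lx e * Y ly e) ∎
      where
      n₀ = not (e zero zero)
      f₁ = loopFree (e ∘ suc) lx
      f₂ = loopFree (λ j i → e i (suc j)) ly
      ch = chain e

    sum-loops : ∀ e → ∑ (λ lx → ∑ (λ ly → A e * (X lx e * Y ly e)) Ly) Lx ≈ edgeWeight e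
    sum-loops e = begin
      ∑ (λ lx → ∑ (λ ly → A e * (X lx e * Y ly e)) Ly) Lx
        ≈⟨ ∑-∑-*ˡ (A e) (λ lx → X lx e) (λ ly → Y ly e) Lx Ly ⟩
      A e * (∑ (λ lx → X lx e) Lx * ∑ (λ ly → Y ly e) Ly)
        ≈⟨ *-congˡ (*-cong (loopSum λ i → any (e (suc i))) (loopSum λ j → column e (suc j))) ⟩
      (ind (n₀ ∧ chain e) * q ^ edgeCount e) * (ρ * κ)
        ≈⟨ *-congʳ (*-congʳ (ind-∧ n₀ (chain e))) ⟩
      ((ind n₀ * ind (chain e)) * q ^ edgeCount e) * (ρ * κ)
        ≈⟨ solve 5 (λ a b c r k → ((a :* b) :* c) :* (r :* k) := a :* ((b :* (c :* (con 1 :* k))) :* r)) refl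
             (ind n₀) (ind (chain e)) (q ^ edgeCount e) ρ κ ⟩
      ind n₀ * ((ind (chain e) * (q ^ edgeCount e * (1# * κ))) * ρ)
        ≈⟨ *-congˡ (*-congʳ (*-congʳ (reflexive (≡.cong ind (≡.sym chain∧above-1))))) ⟩
      edgeWeight e ∎
      where
      n₀ = not (e zero zero)
      ρ = rowWeights (e ∘ suc)
      κ = ∏ λ j → lineWeight (column e (suc j))
      chain∧above-1 : chain e ∧ above 1 e ≡ chain e
      chain∧above-1 = ≡.trans (≡.cong (chain e ∧_) (above-1 e)) (∧-identityʳ _)

  edgeSum≈prefixSum : ∀ m n →
    ∑ edgeWeight (funs (suc m) (funs (suc n) bools)) ≈ prefixSum n (λ d → block (suc n) m (suc d))
  edgeSum≈prefixSum m n = begin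
    ∑ edgeWeight (funs (suc m) (funs (suc n) bools))
      ≈⟨ ∑-funs-suc {k = m} edgeWeight (funs (suc n) bools) (λ _ → refl) ⟩
    ∑ (λ x → ∑ (λ g → edgeWeight (x V.∷ g)) G) (funs (suc n) bools)
      ≈⟨ ∑-cong (funs (suc n) bools) (λ x → trans (∑-cong G (peel x)) (∑-*ˡ _ _ G)) ⟩
    ∑ x₀-term (funs (suc n) bools)
      ≈⟨ ∑-funs-suc {k = n} x₀-term bools (λ _ → refl) ⟩
    ∑ (λ x → x₀-term (false V.∷ x)) X + (∑ (λ x → x₀-term (true V.∷ x)) X + 0#)
      ≈⟨ +-cong (∑-cong X y₀-free) (trans (+-identityʳ _) (trans (∑-cong X y₀-met) (∑-0 X))) ⟩
    prefixSum n (λ d → block (suc n) m (suc d)) + 0#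
      ≈⟨ +-identityʳ _ ⟩
    prefixSum n (λ d → block (suc n) m (suc d)) ∎
    where
    G = funs m (funs (suc n) bools)
    X = funs n bools
    x₀-term : (Fin (suc n) → Bool) → Carrier
    x₀-term x = (ind (not (x zero)) * stepWeight 1 x) * block (suc n) m (next 1 x)
    peel : ∀ x g → edgeWeight (x V.∷ g) ≈
                   (ind (not (x zero)) * stepWeight 1 x) * (chainWeight (next 1 x) g * rowWeights g)
    peel x g = trans (*-congˡ (*-congʳ (chainWeight-cons 1 x g)))
      (solve 4 (λ a b c d → a :* ((b :* c) :* d) := (a :* b) :* (c :* d)) refl
        (ind (not (x zero))) (stepWeight 1 x) (chainWeight (next 1 x) g) (rowWeights g))
    y₀-met : ∀ x → x₀-term (true V.∷ x) ≈ 0#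
    y₀-met x = trans (*-congʳ (zeroˡ _)) (zeroˡ _)
    y₀-free : ∀ x → x₀-term (false V.∷ x) ≈ prefixWeight x * block (suc n) m (suc (top x))
    y₀-free x = *-cong (trans (*-identityˡ _) (trans (*-congʳ (reflexive (≡.cong ind (allowed-1 (false V.∷ x)))))
                  (trans (*-identityˡ _) (*-congˡ (closedColumns-cons 0 false x)))))
                (reflexive (≡.cong (block (suc n) m) (suc-⊔-top-step 0 false (top x))))

theorem4p11 : ∀ {c ℓ} (R : CommutativeSemiring c ℓ) (m n : ℕ) (q t : CommutativeSemiring.Carrier R) →
    CommutativeSemiring._≈_ R (F-triangle R m n q t) (F-formula R m n q t)
theorem4p11 R m n q t = begin
  F-triangle R m n q t        ≈⟨ trans (F≈edgeSum m n) (edgeSum≈prefixSum m n) ⟩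
  prefixSum n ψ               ≈⟨ prefixSum-eval n ψ ⟩
  ψ 0 + q * ahead n ψ         ≈⟨ +-cong (ψ≈H 0 z≤n) (*-congˡ (ahead-cong n λ d d<n → ψ≈H (suc d) d<n)) ⟩
  row₀ H n                    ≈⟨ sym (fold-row₀ (u ^_) m n) ⟩
  fold (row₀ (u ^_)) step m n ≈⟨ fold-cong row₀-u^ m n ⟩
  fold (w ^_) step m n        ≈⟨ sym (binomialSum≈fold m n) ⟩
  binomialSum m n             ≈⟨ sym (formula≈binomialSum m n) ⟩
  F-formula R m n q t         ∎
  where
  open CommutativeSemiring R
  open RS rawSemiring using (_^_)
  open Recurrence R q t
  open Binomial R q t
  open Transfer R q t
  open import Relation.Binary.Reasoning.Setoid setoid
  H : ℕ → Carrier
  H = fold (u ^_) step m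
  ψ : ℕ → Carrier
  ψ d = block (suc n) m (suc d)
  ψ≈H : ∀ d → d ℕ.≤ n → ψ d ≈ H (n ∸ d)
  ψ≈H d d≤n = block≈fold (suc n) m (suc d) (s≤s z≤n) (s≤s d≤n)
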